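{- There is a (black-box, $\le_{dt}$) reduction from $\textsc{Bij-Lossy-Code}$ to $\textsc{Binary-Empty-Child}$.
   Context: Query model with $\le_{dt}$ reductions (decision-tree reductions with log target-input-length plus depth $\mathrm{polylog}$ in the source size). $\textsc{Bij-Lossy-Code}$: given $f:[N]\to[2N]$, $g:[2N]\to[N]$, find $x\in[2N]$ with $f(g(x))\ne x$, or $y\in[N]$ with $g(f(y))\ne y$. $\textsc{Binary-Empty-Child}$: given $V=[K]$ and $F,L,R:V\to V$, a solution is (s1) $u$ with $F(L(u))\ne u$ or $F(R(u))\ne u$ or $L(u)=R(u)\ne u$; (s2) $1$ if $L(1)=1$ or $R(1)=1$ or $F(1)\ne1$; or (s3) $u\in V\setminus\{1\}$ with $u\notin\{L(F(u)),R(F(u))\}$. -}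

module Defs where

open import Data.Nat using (ℕ; zero; suc; _+_; _*_; _^_; _≤_)
open import Data.Nat.Logarithm using (⌈log₂_⌉)
open import Data.Fin using (Fin; zero)
open import Data.Sum using (_⊎_; inj₁; inj₂)
open import Data.Product using (Σ; _×_; _,_)
open import Relation.Binary.PropositionalEquality using (_≡_; _≢_)

record QProblem : Set₁ where
  field
    Query : ℕ → Set
    Ans   : (n : ℕ) → Query n → Set
    size  : ℕ → ℕ
    Sol   : ℕ → Set
    IsSol : (n : ℕ) → ((q : Query n) → Ans n q) → Sol n → Set

  Input : ℕ → Set
  Input n = (q : Query n) → Ans n q

data DT (Q : Set) (A : Q → Set) (R : Set) : Set where
  leaf : R → DT Q A R
  node : (q : Q) → ((a : A q) → DT Q A R) → DT Q A R

eval : ∀ {Q A R} → DT Q A R → ((q : Q) → A q) → R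
eval (leaf r)   x = r
eval (node q k) x = eval (k (x q)) x

data DepthLE {Q : Set} {A : Q → Set} {R : Set} : ℕ → DT Q A R → Set where
  leaf≤ : ∀ {d r} → DepthLE d (leaf r)
  node≤ : ∀ {d q k} → (∀ a → DepthLE d (k a)) → DepthLE (suc d) (node q k)

record ReductionAt (P S : QProblem) (n : ℕ) : Set where
  module P = QProblem P
  module S = QProblem S
  field
    m      : ℕ
    depth  : ℕ
    inst   : (q : S.Query m) → DT (P.Query n) (P.Ans n) (S.Ans m q)
    inst-d : ∀ q → DepthLE depth (inst q)
    sol    : (o : S.Sol m) → DT (P.Query n) (P.Ans n) (P.Sol n)
    sol-d  : ∀ o → DepthLE depth (sol o)
    correct : (x : P.Input n) (o : S.Sol m) →
              S.IsSol m (λ q → eval (inst q) x) o →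
              P.IsSol n x (eval (sol o) x)

_≤dt_ : QProblem → QProblem → Set
P ≤dt S = Σ ℕ λ c → (n : ℕ) → Σ (ReductionAt P S n) λ r →
  ⌈log₂ QProblem.size S (ReductionAt.m r) ⌉ + ReductionAt.depth r
    ≤ (⌈log₂ QProblem.size P n ⌉ + 2) ^ c

-- Bij-Lossy-Code with N = suc n:  f : [N] → [2N],  g : [2N] → [N]

BLC : QProblem
BLC = record
  { Query = λ n → Fin (suc n) ⊎ Fin (2 * suc n)   -- inj₁ y : ask f(y); inj₂ x : ask g(x)
  ; Ans   = λ { n (inj₁ _) → Fin (2 * suc n) ; n (inj₂ _) → Fin (suc n) }
  ; size  = suc
  ; Sol   = λ n → Fin (2 * suc n) ⊎ Fin (suc n)
  ; IsSol = λ n I → λ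
      { (inj₁ x) → I (inj₁ (I (inj₂ x))) ≢ x
      ; (inj₂ y) → I (inj₂ (I (inj₁ y))) ≢ y }
  }

-- Binary-Empty-Child with V = [K], K = suc k; vertex 1 is Fin.zero

data Ptr : Set where
  F L R : Ptr

BEC : QProblem
BEC = record
  { Query = λ k → Fin (suc k) × Ptr
  ; Ans   = λ k _ → Fin (suc k)
  ; size  = suc
  ; Sol   = λ k → Fin (suc k)
  ; IsSol = λ k I u →
      let Fᶠ = λ v → I (v , F)
          Lᶠ = λ v → I (v , L)
          Rᶠ = λ v → I (v , R)
      in
          (Fᶠ (Lᶠ u) ≢ u ⊎ Fᶠ (Rᶠ u) ≢ u ⊎ (Lᶠ u ≡ Rᶠ u × Rᶠ u ≢ u))
        ⊎ (u ≡ zero × (Lᶠ zero ≡ zero ⊎ Rᶠ zero ≡ zero ⊎ Fᶠ zero ≢ zero))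
        ⊎ (u ≢ zero × (u ≢ Lᶠ (Fᶠ u) × u ≢ Rᶠ (Fᶠ u)))
  }

-- Put a binary tree on the N points of [N]: identify the 2N child slots (b , u) with [2N]
-- by a bijection σ, let the b-th child of u be g (σ (b , u)), and let the parent of v be
-- the owner of the slot f v.  Where f and g invert each other this is a consistent tree.
-- The root (vertex 1) must be nobody's child, so σ is chosen, after querying f 1 and f 2,
-- to place these two values in the slots of vertex 2, which is made its own parent and
-- both its own children.  A solution u of the tree instance is then refuted by one of
-- the round trips g (f 1), g (f 2), f (g (σ (0 , u))), f (g (σ (1 , u))), g (f u).
-- For N = 1 the point of [2] outside the image of f is always a solution.

module Submission where

open import Defs
open import Data.Bool using (true; false; if_then_else_)
open import Data.Empty using (⊥-elim)
open import Data.Nat using (ℕ; zero; suc; 2+; _+_; _*_; _^_; _≤_)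
open import Data.Nat.Logarithm using (⌈log₂_⌉)
open import Data.Nat.Properties
  using (≤-trans; +-mono-≤; m≤m+n; m≤n+m; m≤m*n; *-monoʳ-≤; ^-monoˡ-≤;
         *-distribʳ-+)
open import Data.Fin using (Fin; suc; combine; opposite)
open import Data.Fin.Patterns using (0F; 1F)
open import Data.Fin.Properties using (_≟_; *↔×; combine-injectiveˡ)
open import Data.Fin.Permutation using (Permutation; _⟨$⟩ʳ_; _∘ₚ_)
import Data.Fin.Permutation as Perm
import Data.Fin.Permutation.Components as PC
open import Data.List using (List; []; _∷_; length)
open import Data.List.Relation.Unary.All using (All; []; _∷_)
open import Data.Product using (_×_; _,_; proj₂)
open import Data.Sum using (_⊎_; inj₁; inj₂; [_,_])
open import Function.Bundles using (_↔_; Inverse; Injection)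
open import Function.Properties.Inverse using (↔⇒↣)
open import Function.Construct.Composition using (_↔-∘_)
open import Function.Construct.Symmetry using (↔-sym)
open import Relation.Nullary using (¬_; does; yes; no; contradiction)
open import Relation.Nullary.Decidable using (dec-true; dec-false)
open import Relation.Binary.PropositionalEquality
  using (_≡_; _≢_; refl; sym; trans; cong; subst)

transpose-matchˡ : ∀ {n} (i j : Fin n) → PC.transpose i j i ≡ j
transpose-matchˡ i j rewrite dec-true (i ≟ i) refl = refl

transpose-fixes : ∀ {n} {i j k : Fin n} → k ≢ i → k ≢ j → PC.transpose i j k ≡ k
transpose-fixes {i = i} {j} {k} k≢i k≢j
  rewrite dec-false (k ≟ i) k≢i | dec-false (k ≟ j) k≢j = refl

module _ {n} (p₀ p₁ a₀ a₁ : Fin n) where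

  movePair : Permutation n n
  movePair = τ ∘ₚ Perm.transpose (τ ⟨$⟩ʳ p₁) a₁
    where
    τ : Permutation n n
    τ = Perm.transpose p₀ a₀

  movePair-p₁ : movePair ⟨$⟩ʳ p₁ ≡ a₁
  movePair-p₁ = transpose-matchˡ (PC.transpose p₀ a₀ p₁) a₁

  movePair-p₀ : p₀ ≢ p₁ → a₀ ≢ a₁ → movePair ⟨$⟩ʳ p₀ ≡ a₀
  movePair-p₀ p₀≢p₁ a₀≢a₁ rewrite transpose-matchˡ p₀ a₀ =
    transpose-fixes a₀≢τp₁ a₀≢a₁
    where
    a₀≢τp₁ : a₀ ≢ PC.transpose p₀ a₀ p₁
    a₀≢τp₁ e = p₀≢p₁ (Injection.injective (↔⇒↣ (Perm.transpose p₀ a₀))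
                        (trans (transpose-matchˡ p₀ a₀) e))

-- vertices 1 and 2 of the construction above
pattern root = 0F
pattern sink = 1F

module SlotTree {k : ℕ} {X : Set} (σ : (Fin 2 × Fin (2+ k)) ↔ X) where

  V : Set
  V = Fin (2+ k)

  slot : Fin 2 → V → X
  slot b u = Inverse.to σ (b , u)

  owner : X → V
  owner x = proj₂ (Inverse.from σ x)

  owner-slot : ∀ b u → owner (slot b u) ≡ u
  owner-slot b u = cong proj₂ (Inverse.strictlyInverseʳ σ (b , u))

  slot-injective : ∀ {b b′ u u′} → slot b u ≡ slot b′ u′ → (b , u) ≡ (b′ , u′)
  slot-injective = Injection.injective (↔⇒↣ σ)

  slots-distinct : ∀ {u} → slot 0F u ≢ slot 1F u
  slots-distinct e with slot-injective e
  ... | ()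

  parentFrom : V → X → V
  parentFrom root          _ = root
  parentFrom sink          _ = sink
  parentFrom (suc (suc _)) x = owner x

  childFrom : V → V → V
  childFrom sink _ = sink
  childFrom _    c = c

module Tree {k : ℕ} {X : Set} (σ : (Fin 2 × Fin (2+ k)) ↔ X)
            (f : Fin (2+ k) → X) (g : X → Fin (2+ k)) where

  open SlotTree σ

  parent : V → V
  parent v = parentFrom v (f v)

  child : Fin 2 → V → V
  child b v = childFrom v (g (slot b v))

  tree : V × Ptr → V
  tree (v , F) = parent v
  tree (v , L) = child 0F v
  tree (v , R) = child 1F v

  RoundTrip : Fin 2 → V → Set
  RoundTrip b u = f (g (slot b u)) ≡ slot b u

  module _ (slot-root : slot 0F sink ≡ f root) (slot-sink : slot 1F sink ≡ f sink)
           (gf-root : g (f root) ≡ root) (gf-sink : g (f sink) ≡ sink) where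

    f-root≡slot⇒sink : ∀ {b u} → f root ≡ slot b u → u ≡ sink
    f-root≡slot⇒sink e = sym (cong proj₂ (slot-injective (trans slot-root e)))

    f-sink≡slot⇒sink : ∀ {b u} → f sink ≡ slot b u → u ≡ sink
    f-sink≡slot⇒sink e = sym (cong proj₂ (slot-injective (trans slot-sink e)))

    parent-of-slot : ∀ {b u} c → f c ≡ slot b u → u ≢ sink → parent c ≡ u
    parent-of-slot root e u≢sink = contradiction (f-root≡slot⇒sink e) u≢sink
    parent-of-slot sink e u≢sink = contradiction (f-sink≡slot⇒sink e) u≢sink
    parent-of-slot {b} {u} (suc (suc _)) e _ = trans (cong owner e) (owner-slot b u)

    parent-child : ∀ b u → RoundTrip b u → parent (child b u) ≡ u
    parent-child b root          fg = parent-of-slot _ fg λ ()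
    parent-child b sink          _  = refl
    parent-child b (suc (suc _)) fg = parent-of-slot _ fg λ ()

    child≢root : ∀ b u → RoundTrip b u → child b u ≢ root
    child≢root b root          fg e =
      contradiction (f-root≡slot⇒sink (trans (cong f (sym e)) fg)) λ ()
    child≢root b sink          _  ()
    child≢root b (suc (suc _)) fg e =
      contradiction (f-root≡slot⇒sink (trans (cong f (sym e)) fg)) λ ()

    children-distinct : ∀ u → RoundTrip 0F u → RoundTrip 1F u →
                        child 0F u ≡ child 1F u → u ≡ sink
    children-distinct root          fg₀ fg₁ e =
      ⊥-elim (slots-distinct (trans (sym fg₀) (trans (cong f e) fg₁)))
    children-distinct sink          _   _   _ = refl
    children-distinct (suc (suc _)) fg₀ fg₁ e =
      ⊥-elim (slots-distinct (trans (sym fg₀) (trans (cong f e) fg₁)))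

    sink-slot⇒root⊎sink : ∀ b {u} → slot b sink ≡ f u → g (f u) ≡ u →
                          u ≡ root ⊎ u ≡ sink
    sink-slot⇒root⊎sink 0F e gf-u =
      inj₁ (trans (sym gf-u) (trans (cong g (trans (sym e) slot-root)) gf-root))
    sink-slot⇒root⊎sink 1F e gf-u =
      inj₂ (trans (sym gf-u) (trans (cong g (trans (sym e) slot-sink)) gf-sink))

    child-in-slot : ∀ b p {w} → let u = suc (suc w) in
                    slot b p ≡ f u → g (f u) ≡ u → child b p ≡ u
    child-in-slot b root          e gf-u = trans (cong g e) gf-u
    child-in-slot b sink          e gf-u with sink-slot⇒root⊎sink b e gf-u
    ... | inj₁ ()
    ... | inj₂ ()
    child-in-slot b (suc (suc _)) e gf-u = trans (cong g e) gf-u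

    child-of-parent : ∀ u → u ≢ root → g (f u) ≡ u →
                      u ≡ child 0F (parent u) ⊎ u ≡ child 1F (parent u)
    child-of-parent root          u≢root _ = contradiction refl u≢root
    child-of-parent sink          _      _ = inj₁ refl
    child-of-parent (suc (suc w)) _      gf-u
      with Inverse.from σ (f (suc (suc w))) | Inverse.strictlyInverseˡ σ (f (suc (suc w)))
    ... | 0F , p | e = inj₁ (sym (child-in-slot 0F p e gf-u))
    ... | 1F , p | e = inj₂ (sym (child-in-slot 1F p e gf-u))

    consistent⇒¬solution : ∀ u → RoundTrip 0F u → RoundTrip 1F u → g (f u) ≡ u →
                           ¬ QProblem.IsSol BEC (suc k) tree u
    consistent⇒¬solution u fg₀ _ _ (inj₁ (inj₁ ¬pl)) = ¬pl (parent-child 0F u fg₀)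
    consistent⇒¬solution u _ fg₁ _ (inj₁ (inj₂ (inj₁ ¬pr))) = ¬pr (parent-child 1F u fg₁)
    consistent⇒¬solution u fg₀ fg₁ _ (inj₁ (inj₂ (inj₂ (l≡r , r≢u))))
      with children-distinct u fg₀ fg₁ l≡r
    ... | refl = r≢u refl
    consistent⇒¬solution _ fg₀ _ _ (inj₂ (inj₁ (refl , inj₁ l≡root))) =
      child≢root 0F root fg₀ l≡root
    consistent⇒¬solution _ _ fg₁ _ (inj₂ (inj₁ (refl , inj₂ (inj₁ r≡root)))) =
      child≢root 1F root fg₁ r≡root
    consistent⇒¬solution _ _ _ _ (inj₂ (inj₁ (refl , inj₂ (inj₂ p≢root)))) = p≢root refl
    consistent⇒¬solution u _ _ gf-u (inj₂ (inj₂ (u≢root , u≢l , u≢r))) =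
      [ u≢l , u≢r ] (child-of-parent u u≢root gf-u)

orLeaf-depth : ∀ {Q A R d} b {t : DT Q A R} {r : R} →
               DepthLE d t → DepthLE d (if b then t else leaf r)
orLeaf-depth true  t≤d = t≤d
orLeaf-depth false _   = leaf≤

BLCTree : ℕ → Set → Set
BLCTree n = DT (QProblem.Query BLC n) (QProblem.Ans BLC n)

module _ {n : ℕ} where

  open QProblem BLC using (Query; Ans; Sol; Input; IsSol)

  Consistent : Input n → Sol n → Set
  Consistent I (inj₁ x) = I (inj₁ (I (inj₂ x))) ≡ x
  Consistent I (inj₂ y) = I (inj₂ (I (inj₁ y))) ≡ y

  firstInconsistent : List (Sol n) → Sol n → BLCTree n (Sol n)
  firstInconsistent []             d = leaf d
  firstInconsistent (inj₁ x ∷ os) d =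
    node (inj₂ x) λ y → node (inj₁ y) λ x′ →
    if does (x′ ≟ x) then firstInconsistent os d else leaf (inj₁ x)
  firstInconsistent (inj₂ y ∷ os) d =
    node (inj₁ y) λ x → node (inj₂ x) λ y′ →
    if does (y′ ≟ y) then firstInconsistent os d else leaf (inj₂ y)

  firstInconsistent-depth : ∀ os d → DepthLE (length os * 2) (firstInconsistent os d)
  firstInconsistent-depth []             d = leaf≤
  firstInconsistent-depth (inj₁ x ∷ os) d =
    node≤ λ _ → node≤ λ x′ →
    orLeaf-depth (does (x′ ≟ x)) (firstInconsistent-depth os d)
  firstInconsistent-depth (inj₂ y ∷ os) d =
    node≤ λ _ → node≤ λ y′ →
    orLeaf-depth (does (y′ ≟ y)) (firstInconsistent-depth os d)

  firstInconsistent-sound : ∀ (I : Input n) os d → (All (Consistent I) os → IsSol n I d) →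
                            IsSol n I (eval (firstInconsistent os d) I)
  firstInconsistent-sound I []             d h = h []
  firstInconsistent-sound I (inj₁ x ∷ os) d h with I (inj₁ (I (inj₂ x))) ≟ x
  ... | yes c = firstInconsistent-sound I os d (λ cs → h (c ∷ cs))
  ... | no ¬c = ¬c
  firstInconsistent-sound I (inj₂ y ∷ os) d h with I (inj₂ (I (inj₁ y))) ≟ y
  ... | yes c = firstInconsistent-sound I os d (λ cs → h (c ∷ cs))
  ... | no ¬c = ¬c

open SlotTree using (slot; parentFrom; childFrom)

module _ {k : ℕ} where

  Layout : Set
  Layout = (Fin 2 × Fin (2+ k)) ↔ Fin (2 * 2+ k)

  sinkCell : Fin 2 → Fin (2 * 2+ k)
  sinkCell b = combine b sink

  layout : Fin (2 * 2+ k) → Fin (2 * 2+ k) → Layout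
  layout a₀ a₁ = movePair (sinkCell 0F) (sinkCell 1F) a₀ a₁ ↔-∘ ↔-sym *↔×

  layout-sink₁ : ∀ a₀ a₁ → slot (layout a₀ a₁) 1F sink ≡ a₁
  layout-sink₁ a₀ a₁ = movePair-p₁ (sinkCell 0F) (sinkCell 1F) a₀ a₁

  layout-sink₀ : ∀ a₀ a₁ → a₀ ≢ a₁ → slot (layout a₀ a₁) 0F sink ≡ a₀
  layout-sink₀ a₀ a₁ = movePair-p₀ (sinkCell 0F) (sinkCell 1F) a₀ a₁
    λ e → contradiction (combine-injectiveˡ {m = 2} {n = 2+ k} 0F sink 1F sink e) λ ()

  queryLayout : ∀ {R} → (Layout → BLCTree (suc k) R) → BLCTree (suc k) R
  queryLayout t = node (inj₁ root) λ a₀ → node (inj₁ sink) λ a₁ → t (layout a₀ a₁)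

  instanceTree : (q : Fin (2+ k) × Ptr) → BLCTree (suc k) (Fin (2+ k))
  instanceTree (v , F) = queryLayout λ σ →
    node (inj₁ v) λ a → leaf (parentFrom σ v a)
  instanceTree (v , L) = queryLayout λ σ →
    node (inj₂ (slot σ 0F v)) λ c → leaf (childFrom σ v c)
  instanceTree (v , R) = queryLayout λ σ →
    node (inj₂ (slot σ 1F v)) λ c → leaf (childFrom σ v c)

  instanceTree-depth : ∀ q → DepthLE 10 (instanceTree q)
  instanceTree-depth (_ , F) = node≤ λ _ → node≤ λ _ → node≤ λ _ → leaf≤
  instanceTree-depth (_ , L) = node≤ λ _ → node≤ λ _ → node≤ λ _ → leaf≤
  instanceTree-depth (_ , R) = node≤ λ _ → node≤ λ _ → node≤ λ _ → leaf≤

  candidates : Layout → Fin (2+ k) → List (QProblem.Sol BLC (suc k))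
  candidates σ u =
    inj₂ root ∷ inj₂ sink ∷ inj₁ (slot σ 0F u) ∷ inj₁ (slot σ 1F u) ∷ []

  solutionTree : Fin (2+ k) → BLCTree (suc k) (QProblem.Sol BLC (suc k))
  solutionTree u = queryLayout λ σ → firstInconsistent (candidates σ u) (inj₂ u)

  solutionTree-depth : ∀ u → DepthLE 10 (solutionTree u)
  solutionTree-depth u = node≤ λ a₀ → node≤ λ a₁ →
    firstInconsistent-depth (candidates (layout a₀ a₁) u) (inj₂ u)

  solutionTree-correct : ∀ I u →
                         QProblem.IsSol BEC (suc k) (λ q → eval (instanceTree q) I) u →
                         QProblem.IsSol BLC (suc k) I (eval (solutionTree u) I)
  solutionTree-correct I u isSol =
    firstInconsistent-sound I (candidates σ u) (inj₂ u) inconsistent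
    where
    f : Fin (2+ k) → Fin (2 * 2+ k)
    f y = I (inj₁ y)
    g : Fin (2 * 2+ k) → Fin (2+ k)
    g x = I (inj₂ x)
    σ : Layout
    σ = layout (f root) (f sink)
    inconsistent : All (Consistent I) (candidates σ u) → QProblem.IsSol BLC (suc k) I (inj₂ u)
    inconsistent (gf-root ∷ gf-sink ∷ fg₀ ∷ fg₁ ∷ []) gf-u =
      Tree.consistent⇒¬solution σ f g
        (layout-sink₀ (f root) (f sink) f-root≢f-sink) (layout-sink₁ (f root) (f sink))
        gf-root gf-sink u fg₀ fg₁ gf-u isSol
      where
      f-root≢f-sink : f root ≢ f sink
      f-root≢f-sink e = contradiction (trans (sym gf-root) (trans (cong g e) gf-sink)) λ ()

  reduction₂₊ : ReductionAt BLC BEC (suc k)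
  reduction₂₊ = record
    { m       = suc k
    ; depth   = 10
    ; inst    = instanceTree
    ; inst-d  = instanceTree-depth
    ; sol     = solutionTree
    ; sol-d   = solutionTree-depth
    ; correct = solutionTree-correct
    }

opposite-∉-image : (f : Fin 1 → Fin 2) (y : Fin 1) → f y ≢ opposite (f 0F)
opposite-∉-image f 0F with f 0F
... | 0F = λ ()
... | 1F = λ ()

reduction₁ : ReductionAt BLC BEC 0
reduction₁ = record
  { m       = 0
  ; depth   = 10
  ; inst    = λ _ → leaf 0F
  ; inst-d  = λ _ → leaf≤
  ; sol     = λ _ → node (inj₁ 0F) λ a → leaf (inj₁ (opposite a))
  ; sol-d   = λ _ → node≤ λ _ → leaf≤
  ; correct = λ I _ _ → opposite-∉-image (λ y → I (inj₁ y)) _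
  }

n+10≤[n+2]^4 : ∀ n → n + 10 ≤ (n + 2) ^ 4
n+10≤[n+2]^4 n = ≤-trans n+10≤[n+2]*8 ([n+2]*8≤[n+2]^4)
  where
  n+10≤[n+2]*8 : n + 10 ≤ (n + 2) * 8
  n+10≤[n+2]*8 = subst (n + 10 ≤_) (sym (*-distribʳ-+ 8 n 2))
                       (+-mono-≤ (m≤m*n n 8) (m≤m+n 10 6))
  [n+2]*8≤[n+2]^4 : (n + 2) * 8 ≤ (n + 2) ^ 4
  [n+2]*8≤[n+2]^4 = *-monoʳ-≤ (n + 2) (^-monoˡ-≤ 3 (m≤n+m 2 n))

corollary5p10 : BLC ≤dt BEC
corollary5p10 = 4 , λ
  { zero    → reduction₁ , n+10≤[n+2]^4 ⌈log₂ 1 ⌉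
  ; (suc k) → reduction₂₊ , n+10≤[n+2]^4 ⌈log₂ 2+ k ⌉
  }
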